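{- Let $m,n\ge 1$ and let $G$ be the ordered graph with vertices $v_1<\dots<v_{m+n}$ whose only edges are $v_1v_{m+n}$ and $v_mv_{m+1}$ (so $G$ is $2$-ichromatic with parts $\{v_1,\dots,v_m\}$ and $\{v_{m+1},\dots,v_{m+n}\}$, and has two nested edges, one joining the outermost vertices and one joining the innermost vertices). Then $R(G) = 2m+2n-2$.
   Context: An ordered graph is a graph together with a linear ordering of its vertices. An ordered graph $H$ is contained in an ordered graph $H'$ if there is an order-preserving injection $V(H)\to V(H')$ mapping edges to edges. The Ramsey number $R(G)$ of an ordered graph $G$ is the minimum $N$ such that every 2-coloring of the edges of the ordered complete graph on $N$ vertices contains a monochromatic copy of $G$ (in the ordered sense). -}

module Defs where

open import Data.Nat using (ℕ; _+_; _∸_; _≤_; _<_)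
open import Data.Fin using (Fin; toℕ)
open import Data.Bool using (Bool)
open import Data.Product using (Σ; _×_)
open import Relation.Binary.PropositionalEquality using (_≡_)
open import Level using (0ℓ; suc)

-- An ordered graph on k vertices: vertex set Fin k with its natural order,
-- edges given by a relation E (only pairs i < j are ever consulted).
record OrderedGraph : Set₁ where
  field
    size : ℕ
    Edge : Fin size → Fin size → Set
open OrderedGraph public

-- A 2-colouring of the edges of the ordered complete graph on N vertices:
-- the colour of the edge {x,y} with x < y is c x y.
Colouring : ℕ → Set
Colouring N = Fin N → Fin N → Bool

StrictlyIncreasing : {k N : ℕ} → (Fin k → Fin N) → Set
StrictlyIncreasing {k} f = ∀ (i j : Fin k) → toℕ i < toℕ j → toℕ (f i) < toℕ (f j)

MonoCopy : (G : OrderedGraph) {N : ℕ} → Colouring N → Bool → Set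
MonoCopy G {N} c b =
  Σ (Fin (size G) → Fin N) λ f →
    StrictlyIncreasing f ×
    (∀ (i j : Fin (size G)) → toℕ i < toℕ j → Edge G i j → c (f i) (f j) ≡ b)

Arrows : ℕ → OrderedGraph → Set
Arrows N G = ∀ (c : Colouring N) → Σ Bool λ b → MonoCopy G c b

IsRamseyNumber : OrderedGraph → ℕ → Set
IsRamseyNumber G N = Arrows N G × (∀ M → Arrows M G → N ≤ M)

-- The ordered graph on v_1 < ... < v_{m+n} (0-indexed here as 0..m+n-1)
-- whose only edges are v_1 v_{m+n} and v_m v_{m+1}.
nestedTwoEdges : ℕ → ℕ → OrderedGraph
nestedTwoEdges m n = record
  { size = m + n
  ; Edge = λ i j →
      ((toℕ i ≡ 0) × (toℕ j ≡ (m + n) ∸ 1))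
      Data.Sum.⊎ ((toℕ i ≡ m ∸ 1) × (toℕ j ≡ m))
  }
  where import Data.Sum

module Submission where

-- Write p = m - 1 and q = n - 1. Of the three nested edges (0, 2p+2q+1), (p, 2p+q+1),
-- (2p, 2p+1) on 2m+2n-2 vertices two have the same colour, and any two of them span a copy
-- of G: put the left part on an arithmetic progression between their left ends and the
-- right part on one between their right ends (step 1, or step 2 for the outermost and the
-- innermost edge). Conversely, in any copy of G the inner edge is at least p+q shorter than
-- the outer one, which spans at least m+n-1 positions; on fewer than 2m+2n-2 vertices the
-- inner edge then spans fewer than m+n-1, so colouring edges by whether they span at least
-- m+n-1 positions avoids G.

open import Defs
open import Data.Nat using (ℕ; zero; suc; _+_; _*_; _∸_; _≤_; _<_; _≤?_; z≤n; s≤s; z<s; s≤s⁻¹; NonZero)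
open import Data.Nat.Properties
open import Data.Nat.Tactic.RingSolver using (solve-∀)
import Data.Fin as Fin
open import Data.Fin using (Fin; toℕ; fromℕ<; fromℕ)
open import Data.Fin.Properties using (toℕ-fromℕ<; toℕ-fromℕ; toℕ-injective; toℕ<n)
open import Data.Bool using (Bool; true; false)
open import Data.Product using (_,_; proj₂)
open import Data.Sum using (_⊎_; inj₁; inj₂)
open import Relation.Nullary using (yes; no; does; ¬_; contradiction)
open import Relation.Nullary.Decidable using (dec-true; dec-false)
open import Relation.Binary.PropositionalEquality

Bool-pigeonhole : (x y z : Bool) → x ≡ y ⊎ y ≡ z ⊎ x ≡ z
Bool-pigeonhole false false _     = inj₁ refl
Bool-pigeonhole true  true  _     = inj₁ refl
Bool-pigeonhole false true  true  = inj₂ (inj₁ refl)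
Bool-pigeonhole true  false false = inj₂ (inj₁ refl)
Bool-pigeonhole false true  false = inj₂ (inj₂ refl)
Bool-pigeonhole true  false true  = inj₂ (inj₂ refl)

nested-span : ∀ {a b c d p q} → a + p ≤ b → b ≤ c → c + q ≤ d → (c ∸ b) + (p + q) ≤ d ∸ a
nested-span {a} {b} {c} {d} {p} {q} a+p≤b b≤c c+q≤d = m+n≤o⇒m≤o∸n _ (begin
  (c ∸ b) + (p + q) + a ≡⟨ rearrange (c ∸ b) p q a ⟩
  (c ∸ b) + (a + p) + q ≤⟨ +-monoˡ-≤ q (+-monoʳ-≤ (c ∸ b) a+p≤b) ⟩
  (c ∸ b) + b + q       ≡⟨ cong (_+ q) (m∸n+n≡m b≤c) ⟩
  c + q                 ≤⟨ c+q≤d ⟩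
  d                     ∎)
  where
  open ≤-Reasoning
  rearrange : ∀ x p q a → x + (p + q) + a ≡ x + (a + p) + q
  rearrange = solve-∀

StrictlyIncreasing-spread : ∀ {k N} {f : Fin k → Fin N} → StrictlyIncreasing f →
  ∀ d (i j : Fin k) → toℕ j ≡ toℕ i + d → toℕ (f i) + d ≤ toℕ (f j)
StrictlyIncreasing-spread {f = f} inc zero i j j≡i+0
  rewrite toℕ-injective (trans j≡i+0 (+-identityʳ (toℕ i))) = ≤-reflexive (+-identityʳ _)
StrictlyIncreasing-spread {k} {f = f} inc (suc d) i j j≡i+1+d = begin
  toℕ (f i) + suc d  ≡⟨ +-suc (toℕ (f i)) d ⟩
  suc (toℕ (f i) + d) ≤⟨ s≤s (StrictlyIncreasing-spread inc d i j′ (toℕ-fromℕ< i+d<k)) ⟩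
  suc (toℕ (f j′))    ≤⟨ inc j′ j j′<j ⟩
  toℕ (f j)           ∎
  where
  open ≤-Reasoning
  i+d<j : toℕ i + d < toℕ j
  i+d<j = ≤-reflexive (sym (trans j≡i+1+d (+-suc (toℕ i) d)))
  i+d<k : toℕ i + d < k
  i+d<k = <-trans i+d<j (toℕ<n j)
  j′ : Fin k
  j′ = fromℕ< i+d<k
  j′<j : toℕ j′ < toℕ j
  j′<j = subst (_< toℕ j) (sym (toℕ-fromℕ< i+d<k)) i+d<j

lengthColouring : ∀ {M} → ℕ → Colouring M
lengthColouring k x y = does (k ≤? toℕ y ∸ toℕ x)

module _ (p q : ℕ) where

  G : OrderedGraph
  G = nestedTwoEdges (suc p) (suc q)

  K : ℕ
  K = p + suc q

  module _ {N : ℕ} (β : ℕ) .{{_ : NonZero β}} {A B C D : Fin N}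
           (A→B : toℕ A + β * p ≡ toℕ B) (B<C : toℕ B < toℕ C) (C→D : toℕ C + β * q ≡ toℕ D)
           where

    place : ℕ → ℕ
    place x with x ≤? p
    ... | yes _ = toℕ A + β * x
    ... | no  _ = toℕ C + β * (x ∸ suc p)

    place-left : ∀ {x} → x ≤ p → place x ≡ toℕ A + β * x
    place-left {x} x≤p with x ≤? p
    ... | yes _   = refl
    ... | no  x≰p = contradiction x≤p x≰p

    place-right : ∀ {x} → p < x → place x ≡ toℕ C + β * (x ∸ suc p)
    place-right {x} p<x with x ≤? p
    ... | yes x≤p = contradiction x≤p (<⇒≱ p<x)
    ... | no  _   = refl

    left<C : ∀ {x} → x ≤ p → toℕ A + β * x < toℕ C
    left<C x≤p = ≤-<-trans (≤-trans (+-monoʳ-≤ _ (*-monoʳ-≤ β x≤p)) (≤-reflexive A→B)) B<C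

    place-increasing : ∀ {x y} → x < y → place x < place y
    place-increasing {x} {y} x<y with x ≤? p | y ≤? p
    ... | yes _   | yes _   = +-monoʳ-< _ (*-monoʳ-< β x<y)
    ... | yes x≤p | no  _   = <-≤-trans (left<C x≤p) (m≤m+n _ _)
    ... | no  x≰p | yes y≤p = contradiction (≤-trans (<⇒≤ x<y) y≤p) x≰p
    ... | no  x≰p | no  _   = +-monoʳ-< _ (*-monoʳ-< β (∸-monoˡ-< x<y (≰⇒> x≰p)))

    place-bounded : ∀ {x} → x ≤ K → place x ≤ toℕ D
    place-bounded {x} x≤K with x ≤? p
    ... | yes x≤p = ≤-trans (<⇒≤ (left<C x≤p)) (≤-trans (m≤m+n _ _) (≤-reflexive C→D))
    ... | no  _   = ≤-trans (+-monoʳ-≤ _ (*-monoʳ-≤ β x∸p≤q)) (≤-reflexive C→D)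
      where
      x∸p≤q : x ∸ suc p ≤ q
      x∸p≤q = m≤n+o⇒m∸n≤o x (suc p) (≤-trans x≤K (≤-reflexive (+-suc p q)))

    embed : Fin (size G) → Fin N
    embed i = fromℕ< (≤-<-trans (place-bounded (s≤s⁻¹ (toℕ<n i))) (toℕ<n D))

    embed-at : ∀ {i x} {X : Fin N} → toℕ i ≡ x → place x ≡ toℕ X → embed i ≡ X
    embed-at {i} refl place≡X = toℕ-injective (trans (toℕ-fromℕ< _) place≡X)

    nestedEdges-copy : ∀ {col : Colouring N} {b} → col A D ≡ b → col B C ≡ b → MonoCopy G col b
    nestedEdges-copy {col} {b} AD BC = embed , increasing , edges
      where
      increasing : StrictlyIncreasing embed
      increasing i j i<j = subst₂ _<_ (sym (toℕ-fromℕ< _)) (sym (toℕ-fromℕ< _)) (place-increasing i<j)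

      coloured : ∀ {i j X Y x y} → col X Y ≡ b → toℕ i ≡ x → place x ≡ toℕ X →
                 toℕ j ≡ y → place y ≡ toℕ Y → col (embed i) (embed j) ≡ b
      coloured XY i≡x x↦X j≡y y↦Y =
        subst₂ (λ u v → col u v ≡ b) (sym (embed-at i≡x x↦X)) (sym (embed-at j≡y y↦Y)) XY

      edges : ∀ i j → toℕ i < toℕ j → Edge G i j → col (embed i) (embed j) ≡ b
      edges i j _ (inj₁ (i≡0 , j≡K)) = coloured AD i≡0 place-0 j≡K place-K
        where
        place-0 : place 0 ≡ toℕ A
        place-0 = trans (place-left z≤n) (trans (cong (toℕ A +_) (*-zeroʳ β)) (+-identityʳ _))
        place-K : place K ≡ toℕ D
        place-K = trans (place-right (m<m+n p z<s))
                    (trans (cong (λ z → toℕ C + β * (z ∸ suc p)) (+-suc p q))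
                      (trans (cong (λ z → toℕ C + β * z) (m+n∸m≡n p q)) C→D))
      edges i j _ (inj₂ (i≡p , j≡p+1)) = coloured BC i≡p place-p j≡p+1 place-p+1
        where
        place-p : place p ≡ toℕ B
        place-p = trans (place-left ≤-refl) A→B
        place-p+1 : place (suc p) ≡ toℕ C
        place-p+1 = trans (place-right ≤-refl)
                      (trans (cong (λ z → toℕ C + β * z) (n∸n≡0 p))
                        (trans (cong (toℕ C +_) (*-zeroʳ β)) (+-identityʳ _)))

  lengthColouring-avoids : ∀ {M b} → M ≤ K + (p + q) → ¬ MonoCopy G (lengthColouring {M} K) b
  lengthColouring-avoids {M} {b} M≤ (f , increasing , coloured) =
    contradiction (trans (sym outer-true) (trans outer-coloured (trans (sym inner-coloured) inner-false))) λ ()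
    where
    p<size : p < size G
    p<size = s≤s (m≤m+n p (suc q))
    p+1<size : suc p < size G
    p+1<size = s≤s (≤-trans (s≤s (m≤m+n p q)) (≤-reflexive (sym (+-suc p q))))

    first last mid mid+1 : Fin (size G)
    first = Fin.zero
    last  = fromℕ K
    mid   = fromℕ< p<size
    mid+1 = fromℕ< p+1<size

    mid<mid+1 : toℕ mid < toℕ mid+1
    mid<mid+1 = subst₂ _<_ (sym (toℕ-fromℕ< p<size)) (sym (toℕ-fromℕ< p+1<size)) ≤-refl

    a b′ c d : ℕ
    a  = toℕ (f first)
    b′ = toℕ (f mid)
    c  = toℕ (f mid+1)
    d  = toℕ (f last)

    outer-long : K ≤ d ∸ a
    outer-long = m+n≤o⇒m≤o∸n K (subst (_≤ d) (+-comm a K)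
                   (StrictlyIncreasing-spread increasing K first last (toℕ-fromℕ K)))

    inner-short : (c ∸ b′) + (p + q) ≤ d ∸ a
    inner-short = nested-span
      (StrictlyIncreasing-spread increasing p first mid (toℕ-fromℕ< p<size))
      (<⇒≤ (increasing mid mid+1 mid<mid+1))
      (StrictlyIncreasing-spread increasing q mid+1 last
        (trans (toℕ-fromℕ K) (trans (+-suc p q) (cong (_+ q) (sym (toℕ-fromℕ< p+1<size))))))

    inner<K : c ∸ b′ < K
    inner<K = +-cancelʳ-< (p + q) (c ∸ b′) K
      (≤-<-trans inner-short (≤-<-trans (m∸n≤m d a) (<-≤-trans (toℕ<n (f last)) M≤)))

    outer-true : lengthColouring K (f first) (f last) ≡ true
    outer-true = dec-true (K ≤? d ∸ a) outer-long

    inner-false : lengthColouring K (f mid) (f mid+1) ≡ false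
    inner-false = dec-false (K ≤? c ∸ b′) (<⇒≱ inner<K)

    outer-coloured : lengthColouring K (f first) (f last) ≡ b
    outer-coloured = coloured first last (subst (0 <_) (sym (toℕ-fromℕ K)) (<-≤-trans z<s (m≤n+m (suc q) p)))
                       (inj₁ (refl , toℕ-fromℕ K))

    inner-coloured : lengthColouring K (f mid) (f mid+1) ≡ b
    inner-coloured = coloured mid mid+1 mid<mid+1 (inj₂ (toℕ-fromℕ< p<size , toℕ-fromℕ< p+1<size))

  N : ℕ
  N = suc (p + p) + suc (q + q)

  arrows⇒N≤ : ∀ M → Arrows M G → N ≤ M
  arrows⇒N≤ M arrows = ≮⇒≥ λ M<N →
    lengthColouring-avoids (≤-trans (s≤s⁻¹ M<N) (≤-reflexive (N-1≡ p q))) (proj₂ (arrows (lengthColouring K)))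
    where
    N-1≡ : ∀ p q → p + p + suc (q + q) ≡ p + suc q + (p + q)
    N-1≡ = solve-∀

  -- The bounds are irrelevant so that vertices built from different bound proofs coincide.
  leftVertex : (x : ℕ) → .(x ≤ p + p) → Fin N
  leftVertex x x≤2p = fromℕ< (≤-trans (s≤s x≤2p) (m≤m+n _ _))

  rightVertex : (y : ℕ) → .(y ≤ q + q) → Fin N
  rightVertex y y≤2q = fromℕ< (+-monoʳ-< (suc (p + p)) (s≤s y≤2q))

  toℕ-leftVertex : ∀ x .(x≤2p : x ≤ p + p) → toℕ (leftVertex x x≤2p) ≡ x
  toℕ-leftVertex x x≤2p = toℕ-fromℕ< (≤-trans (s≤s x≤2p) (m≤m+n _ _))

  toℕ-rightVertex : ∀ y .(y≤2q : y ≤ q + q) → toℕ (rightVertex y y≤2q) ≡ suc (p + p) + y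
  toℕ-rightVertex y y≤2q = toℕ-fromℕ< (+-monoʳ-< (suc (p + p)) (s≤s y≤2q))

  leftVertex-step : ∀ {x y k} .(x≤2p : x ≤ p + p) .(y≤2p : y ≤ p + p) → x + k ≡ y →
                    toℕ (leftVertex x x≤2p) + k ≡ toℕ (leftVertex y y≤2p)
  leftVertex-step {x} {y} {k} x≤2p y≤2p x+k≡y =
    trans (cong (_+ k) (toℕ-leftVertex x x≤2p)) (trans x+k≡y (sym (toℕ-leftVertex y y≤2p)))

  rightVertex-step : ∀ {x y k} .(x≤2q : x ≤ q + q) .(y≤2q : y ≤ q + q) → x + k ≡ y →
                     toℕ (rightVertex x x≤2q) + k ≡ toℕ (rightVertex y y≤2q)
  rightVertex-step {x} {y} {k} x≤2q y≤2q x+k≡y = begin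
    toℕ (rightVertex x x≤2q) + k ≡⟨ cong (_+ k) (toℕ-rightVertex x x≤2q) ⟩
    suc (p + p) + x + k         ≡⟨ +-assoc (suc (p + p)) x k ⟩
    suc (p + p) + (x + k)       ≡⟨ cong (suc (p + p) +_) x+k≡y ⟩
    suc (p + p) + y             ≡⟨ toℕ-rightVertex y y≤2q ⟨
    toℕ (rightVertex y y≤2q)    ∎
    where open ≡-Reasoning

  left<right : ∀ {x y} (x≤2p : x ≤ p + p) .(y≤2q : y ≤ q + q) →
               toℕ (leftVertex x x≤2p) < toℕ (rightVertex y y≤2q)
  left<right {x} {y} x≤2p y≤2q = subst₂ _<_ (sym (toℕ-leftVertex x x≤2p)) (sym (toℕ-rightVertex y y≤2q))
    (≤-trans (s≤s x≤2p) (m≤m+n _ _))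

  outerL middleL innerL innerR middleR outerR : Fin N
  outerL  = leftVertex 0 z≤n
  middleL = leftVertex p (m≤m+n p p)
  innerL  = leftVertex (p + p) ≤-refl
  innerR  = rightVertex 0 z≤n
  middleR = rightVertex q (m≤m+n q q)
  outerR  = rightVertex (q + q) ≤-refl

  arrows : Arrows N G
  arrows col with Bool-pigeonhole (col outerL outerR) (col middleL middleR) (col innerL innerR)
  ... | inj₁ outer≡middle = _ , nestedEdges-copy 1
          (leftVertex-step z≤n (m≤m+n p p) (*-identityˡ p)) (left<right (m≤m+n p p) (m≤m+n q q))
          (rightVertex-step (m≤m+n q q) ≤-refl (cong (q +_) (*-identityˡ q)))
          {col} refl (sym outer≡middle)
  ... | inj₂ (inj₁ middle≡inner) = _ , nestedEdges-copy 1
          (leftVertex-step (m≤m+n p p) ≤-refl (cong (p +_) (*-identityˡ p))) (left<right ≤-refl z≤n)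
          (rightVertex-step z≤n (m≤m+n q q) (*-identityˡ q))
          {col} refl (sym middle≡inner)
  ... | inj₂ (inj₂ outer≡inner) = _ , nestedEdges-copy 2
          (leftVertex-step z≤n ≤-refl (cong (p +_) (+-identityʳ p))) (left<right ≤-refl z≤n)
          (rightVertex-step z≤n ≤-refl (cong (q +_) (+-identityʳ q)))
          {col} refl (sym outer≡inner)

proposition1 : ∀ (m n : ℕ) → 1 ≤ m → 1 ≤ n →
    IsRamseyNumber (nestedTwoEdges m n) ((2 * m + 2 * n) ∸ 2)
proposition1 (suc p) (suc q) _ _ =
  subst (IsRamseyNumber (G p q)) (cong (_∸ 2) (2+N≡ p q)) (arrows p q , arrows⇒N≤ p q)
  where
  2+N≡ : ∀ p q → 2 + (suc (p + p) + suc (q + q)) ≡ 2 * suc p + 2 * suc q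
  2+N≡ = solve-∀
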